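{- Let $\mathcal{C}$ be a binary Boolean VCSP instance with associated fitness graph $G_\mathcal{C}$, and let $i\neq j$. If $i$ and $j$ sign-interact in $G_\mathcal{C}$, then the binary constraint $C_{ij}$ of $\mathcal{C}$ with scope $\{i,j\}$ is not the zero function (in particular, $\mathcal{C}$ contains a constraint with scope $\{i,j\}$).
   Context: Variables are indexed by $[n]$, each with domain $\{0,1\}$; $x[i\mapsto b]$ is $x$ with coordinate $i$ set to $b$, $\bar b=1-b$. A (valued) constraint with scope $S\subseteq[n]$ is a function $C_S:\{0,1\}^S\to\mathbb{Z}$. A binary Boolean VCSP instance is a finite set of constraints with scopes of size at most $2$, at most one per scope; $C_{ij}$ denotes the constraint with scope $\{i,j\}$ (taken to be the zero function if absent). It implements $f(x)=\sum_{C_S\in\mathcal{C}}C_S(x[S])$. Its fitness graph $G_\mathcal{C}$ has vertex set $\{0,1\}^n$ and a directed edge $(x,y)$ iff $x,y$ differ in exactly one coordinate and $f(y)>f(x)$. In $G_\mathcal{C}$, $i$ sign-depends on $j$ if there is $x$ with $(x,x[i\mapsto\bar x_i])\in E(G_\mathcal{C})$ but $(x[j\mapsto \bar x_j],x[i\mapsto\bar x_i,j\mapsto\bar x_j])\notin E(G_\mathcal{C})$; $i,j$ sign-interact if $i$ sign-depends on $j$ or $j$ sign-depends on $i$. -}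

module Defs where

open import Data.Nat using (ℕ)
open import Data.Fin using (Fin; _<_; _≟_)
open import Data.Fin.Properties using (<-cmp)
open import Data.Bool using (Bool; true; false; not)
open import Data.Integer using (ℤ; 0ℤ; _+_; _<_)
open import Data.List using (List; []; _∷_; map)
open import Data.List.Relation.Unary.Unique.Propositional using (Unique)
open import Data.Product using (Σ; ∃; ∃-syntax; _×_; _,_; proj₁)
open import Data.Sum using (_⊎_)
open import Relation.Binary.PropositionalEquality using (_≡_)
open import Relation.Nullary using (¬_; yes; no)
open import Relation.Binary.Definitions using (tri<; tri≈; tri>)

-- Assignments x ∈ {0,1}^n, with 0 = false, 1 = true.
Assignment : ℕ → Set
Assignment n = Fin n → Bool

_[_↦_] : ∀ {n} → Assignment n → Fin n → Bool → Assignment n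
(x [ i ↦ b ]) k with k ≟ i
... | yes _ = b
... | no  _ = x k

flip : ∀ {n} → Assignment n → Fin n → Assignment n
flip x i = x [ i ↦ not (x i) ]

-- Scopes of size at most 2.  A two-element scope {i,j} is represented
-- canonically as  pair i j  with  i < j.
data Scope (n : ℕ) : Set where
  empty : Scope n
  single : Fin n → Scope n
  pair : (i j : Fin n) → i Data.Fin.< j → Scope n

-- The type of functions {0,1}^S → ℤ for a scope S.
-- For  pair i j _  the first argument is the value of x_i, the second of x_j.
ScopeFun : ∀ {n} → Scope n → Set
ScopeFun empty = ℤ
ScopeFun (single _) = Bool → ℤ
ScopeFun (pair _ _ _) = Bool → Bool → ℤ

Constraint : ℕ → Set
Constraint n = Σ (Scope n) ScopeFun

scope : ∀ {n} → Constraint n → Scope n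
scope = proj₁

evalC : ∀ {n} → Constraint n → Assignment n → ℤ
evalC (empty , c) x = c
evalC (single i , c) x = c (x i)
evalC (pair i j _ , c) x = c (x i) (x j)

-- A binary Boolean VCSP instance: a finite set of constraints with scopes of
-- size ≤ 2, at most one per scope (scopes pairwise distinct).
record Instance (n : ℕ) : Set where
  constructor mkInstance
  field
    constraints : List (Constraint n)
    uniqueScopes : Unique (map scope constraints)
open Instance public

sumC : ∀ {n} → List (Constraint n) → Assignment n → ℤ
sumC [] x = 0ℤ
sumC (c ∷ cs) x = evalC c x + sumC cs x

fitness : ∀ {n} → Instance n → Assignment n → ℤ
fitness 𝒞 = sumC (constraints 𝒞)

-- Edges of the fitness graph G_𝒞: x,y differ in exactly one coordinate
-- and f(y) > f(x).  We give the edge relation in the form needed here: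
-- an edge from x to flip x i (for some coordinate i).
FlipEdge : ∀ {n} → Instance n → Assignment n → Fin n → Set
FlipEdge 𝒞 x i = fitness 𝒞 x Data.Integer.< fitness 𝒞 (flip x i)

SignDepends : ∀ {n} → Instance n → Fin n → Fin n → Set
SignDepends 𝒞 i j =
  ∃[ x ] (FlipEdge 𝒞 x i × ¬ FlipEdge 𝒞 (flip x j) i)

SignInteract : ∀ {n} → Instance n → Fin n → Fin n → Set
SignInteract 𝒞 i j = SignDepends 𝒞 i j ⊎ SignDepends 𝒞 j i

-- The binary constraint with scope {i,j} (i < j), as a function of (x_i, x_j);
-- the zero function if absent.
lookupPair : ∀ {n} (i j : Fin n) → List (Constraint n) → Bool → Bool → ℤ
lookupPair i j [] a b = 0ℤ
lookupPair i j ((pair k l _ , c) ∷ cs) a b with k ≟ i | l ≟ j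
... | yes _ | yes _ = c a b
... | _ | _ = lookupPair i j cs a b
lookupPair i j ((empty , _) ∷ cs) a b = lookupPair i j cs a b
lookupPair i j ((single _ , _) ∷ cs) a b = lookupPair i j cs a b

-- C_ij as a function of (x_i, x_j), for any i, j (order handled canonically);
-- zero function when i = j (no such scope).
Cij : ∀ {n} → Instance n → (i j : Fin n) → Bool → Bool → ℤ
Cij 𝒞 i j a b with <-cmp i j
... | tri< _ _ _ = lookupPair i j (constraints 𝒞) a b
... | tri≈ _ _ _ = 0ℤ
... | tri> _ _ _ = lookupPair j i (constraints 𝒞) b a

IsZeroFun : (Bool → Bool → ℤ) → Set
IsZeroFun c = ∀ a b → c a b ≡ 0ℤ

-- Write gain h i x = h(x with x_i flipped) − h(x).  Gains are additive over
-- constraints, and a constraint that misses i, misses j, or is identically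
-- zero contributes a gain for i that is unchanged by flipping j.  If C_ij is
-- zero then, by uniqueness of scopes, every constraint is of one of these
-- kinds, so the gain of flipping i in f does not depend on x_j; since an edge
-- along coordinate i is exactly a positive gain, i cannot sign-depend on j.
module Submission where

open import Defs
open import Data.Nat using (ℕ)
open import Data.Fin using (Fin; _≟_) renaming (_<_ to _<ᶠ_)
open import Data.Fin.Properties using (<-cmp; <-irrefl; <-asym; <-irrelevant)
open import Data.Bool using (not)
open import Data.Integer using (ℤ; 0ℤ; _+_; _-_; _<_)
open import Data.Integer.Properties using (+-inverseʳ; +-monoʳ-<)
open import Data.Integer.Solver using (module +-*-Solver)
open import Data.List using (List; []; _∷_; map)
open import Data.List.Relation.Unary.All as All using (All; []; _∷_)
open import Data.List.Relation.Unary.All.Properties using (map⁻)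
open import Data.List.Relation.Unary.AllPairs using (_∷_)
open import Data.List.Relation.Unary.Unique.Propositional using (Unique)
open import Data.Product using (∃; _,_; proj₂)
open import Data.Sum using (_⊎_; inj₁; inj₂)
open import Data.Empty using (⊥; ⊥-elim)
open import Relation.Binary.Definitions using (tri<; tri≈; tri>)
open import Relation.Binary.PropositionalEquality
open import Relation.Nullary using (¬_; Dec; yes; no)
open import Relation.Nullary.Decidable using (_⊎-dec_)

open +-*-Solver using (solve; _:+_; _:-_; _:=_)

module _ {n : ℕ} where

  flip-self : (x : Assignment n) (i : Fin n) → flip x i i ≡ not (x i)
  flip-self x i with i ≟ i
  ... | yes _   = refl
  ... | no i≢i = ⊥-elim (i≢i refl)

  flip-≢ : (x : Assignment n) {i k : Fin n} → k ≢ i → flip x i k ≡ x k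
  flip-≢ x {i} {k} k≢i with k ≟ i
  ... | yes k≡i = ⊥-elim (k≢i k≡i)
  ... | no _    = refl

  flip-flip-≢ : (x : Assignment n) {i j k : Fin n} → k ≢ j → flip (flip x j) i k ≡ flip x i k
  flip-flip-≢ x {i} {j} {k} k≢j = by-cases (k ≟ i)
    where
    by-cases : Dec (k ≡ i) → flip (flip x j) i k ≡ flip x i k
    by-cases (yes refl) = trans (flip-self (flip x j) k) (trans (cong not (flip-≢ x k≢j)) (sym (flip-self x k)))
    by-cases (no k≢i)   = trans (flip-≢ (flip x j) k≢i) (trans (flip-≢ x k≢j) (sym (flip-≢ x k≢i)))

  _∈ˢ_ : Fin n → Scope n → Set
  k ∈ˢ empty      = ⊥
  k ∈ˢ single l   = k ≡ l
  k ∈ˢ pair l m _ = k ≡ l ⊎ k ≡ m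

  _∈ˢ?_ : (k : Fin n) (s : Scope n) → Dec (k ∈ˢ s)
  k ∈ˢ? empty      = no λ ()
  k ∈ˢ? single l   = k ≟ l
  k ∈ˢ? pair l m _ = (k ≟ l) ⊎-dec (k ≟ m)

  ∈ˢ-pair : ∀ {k l} {s : Scope n} → k <ᶠ l → k ∈ˢ s → l ∈ˢ s → ∃ λ p → s ≡ pair k l p
  ∈ˢ-pair {s = single _}   k<l refl        refl        = ⊥-elim (<-irrefl refl k<l)
  ∈ˢ-pair {s = pair _ _ p} k<l (inj₁ refl) (inj₂ refl) = p , refl
  ∈ˢ-pair {s = pair _ _ _} k<l (inj₁ refl) (inj₁ refl) = ⊥-elim (<-irrefl refl k<l)
  ∈ˢ-pair {s = pair _ _ p} k<l (inj₂ refl) (inj₁ refl) = ⊥-elim (<-asym k<l p)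
  ∈ˢ-pair {s = pair _ _ _} k<l (inj₂ refl) (inj₂ refl) = ⊥-elim (<-irrefl refl k<l)

  evalC-local : (c : Constraint n) {x y : Assignment n} →
    (∀ {k} → k ∈ˢ scope c → x k ≡ y k) → evalC c x ≡ evalC c y
  evalC-local (empty , f)      agree = refl
  evalC-local (single _ , f)   agree = cong f (agree refl)
  evalC-local (pair _ _ _ , f) agree = cong₂ f (agree (inj₁ refl)) (agree (inj₂ refl))

  evalC-flip-∉ : (c : Constraint n) (x : Assignment n) {i : Fin n} → ¬ i ∈ˢ scope c →
    evalC c (flip x i) ≡ evalC c x
  evalC-flip-∉ c x i∉ = evalC-local c λ {k} k∈ → flip-≢ x λ { refl → i∉ k∈ }

  gain : (Assignment n → ℤ) → Fin n → Assignment n → ℤ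
  gain h i x = h (flip x i) - h x

  GainIndependent : (Assignment n → ℤ) → Fin n → Fin n → Set
  GainIndependent h i j = ∀ x → gain h i (flip x j) ≡ gain h i x

  gainIndependent-+ : ∀ {g h i j} → GainIndependent g i j → GainIndependent h i j →
    GainIndependent (λ x → g x + h x) i j
  gainIndependent-+ {g} {h} {i} {j} gᵢ hᵢ x = begin
    gain (λ y → g y + h y) i (flip x j) ≡⟨ gain-+ (flip x j) ⟩
    gain g i (flip x j) + gain h i (flip x j) ≡⟨ cong₂ _+_ (gᵢ x) (hᵢ x) ⟩
    gain g i x + gain h i x ≡⟨ sym (gain-+ x) ⟩
    gain (λ y → g y + h y) i x ∎
    where
    open ≡-Reasoning
    gain-+ : ∀ y → gain (λ y → g y + h y) i y ≡ gain g i y + gain h i y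
    gain-+ y = solve 4 (λ a b c d → (a :+ b) :- (c :+ d) := (a :- c) :+ (b :- d)) refl
      (g (flip y i)) (h (flip y i)) (g y) (h y)

  <-from-equal-difference : ∀ {a b c d : ℤ} → a < b → b - a ≡ d - c → c < d
  <-from-equal-difference {a} {b} {c} {d} a<b eq = subst₂ _<_ left right (+-monoʳ-< (c - a) a<b)
    where
    left : (c - a) + a ≡ c
    left = solve 2 (λ a c → (c :- a) :+ a := c) refl a c
    right : (c - a) + b ≡ d
    right = begin
      (c - a) + b ≡⟨ solve 3 (λ a b c → (c :- a) :+ b := c :+ (b :- a)) refl a b c ⟩
      c + (b - a) ≡⟨ cong (c +_) eq ⟩
      c + (d - c) ≡⟨ solve 2 (λ c d → c :+ (d :- c) := d) refl c d ⟩
      d ∎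
      where open ≡-Reasoning

  data Decoupled (i j : Fin n) (c : Constraint n) : Set where
    ∉ˡ   : ¬ i ∈ˢ scope c → Decoupled i j c
    ∉ʳ   : ¬ j ∈ˢ scope c → Decoupled i j c
    null : (∀ x → evalC c x ≡ 0ℤ) → Decoupled i j c

  decoupled-sym : ∀ {i j c} → Decoupled i j c → Decoupled j i c
  decoupled-sym (∉ˡ i∉)   = ∉ʳ i∉
  decoupled-sym (∉ʳ j∉)   = ∉ˡ j∉
  decoupled-sym (null z) = null z

  decoupled-gainIndependent : ∀ {i j c} → Decoupled i j c → GainIndependent (evalC c) i j
  decoupled-gainIndependent {i} {j} {c} (∉ˡ i∉) x = trans (no-gain (flip x j)) (sym (no-gain x))
    where
    no-gain : ∀ y → gain (evalC c) i y ≡ 0ℤ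
    no-gain y = trans (cong (_- evalC c y) (evalC-flip-∉ c y i∉)) (+-inverseʳ (evalC c y))
  decoupled-gainIndependent {i} {j} {c} (∉ʳ j∉) x =
    cong₂ _-_ (evalC-local c λ {k} k∈ → flip-flip-≢ x {i} (λ k≡j → j∉ (subst (_∈ˢ scope c) k≡j k∈)))
              (evalC-flip-∉ c x j∉)
  decoupled-gainIndependent {i} {j} (null z) x =
    cong₂ _-_ (trans (z (flip (flip x j) i)) (sym (z (flip x i)))) (trans (z (flip x j)) (sym (z x)))

  sumC-gainIndependent : ∀ {i j} {cs : List (Constraint n)} → All (Decoupled i j) cs →
    GainIndependent (sumC cs) i j
  sumC-gainIndependent []       x = refl
  sumC-gainIndependent {cs = c ∷ cs} (d ∷ ds) =
    gainIndependent-+ {evalC c} {sumC cs} (decoupled-gainIndependent d) (sumC-gainIndependent ds)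

  unpaired-decoupled : ∀ {k l} {c : Constraint n} → k <ᶠ l →
    (∀ p → scope c ≢ pair k l p) → Decoupled k l c
  unpaired-decoupled {k} {l} {c} k<l unpaired with k ∈ˢ? scope c | l ∈ˢ? scope c
  ... | no k∉   | _      = ∉ˡ k∉
  ... | yes _   | no l∉  = ∉ʳ l∉
  ... | yes k∈  | yes l∈ = ⊥-elim (unpaired _ (proj₂ (∈ˢ-pair k<l k∈ l∈)))

  lookupPair-zero⇒decoupled : ∀ {k l} (cs : List (Constraint n)) → k <ᶠ l →
    Unique (map scope cs) → (∀ a b → lookupPair k l cs a b ≡ 0ℤ) → All (Decoupled k l) cs
  lookupPair-zero⇒decoupled [] _ _ _ = []
  lookupPair-zero⇒decoupled ((empty , _) ∷ cs) k<l (_ ∷ u) z =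
    ∉ˡ (λ ()) ∷ lookupPair-zero⇒decoupled cs k<l u z
  lookupPair-zero⇒decoupled ((single _ , _) ∷ cs) k<l (_ ∷ u) z =
    unpaired-decoupled k<l (λ _ ()) ∷ lookupPair-zero⇒decoupled cs k<l u z
  lookupPair-zero⇒decoupled {k} {l} ((pair m m' q , f) ∷ cs) k<l (fresh ∷ u) z with m ≟ k | m' ≟ l
  ... | yes refl | yes refl = null (λ x → z (x m) (x m')) ∷ All.map unpaired (map⁻ fresh)
    where
    unpaired : ∀ {c} → pair m m' q ≢ scope c → Decoupled m m' c
    unpaired ne =
      unpaired-decoupled k<l λ p eq → ne (sym (trans eq (cong (pair m m') (<-irrelevant p q))))
  ... | yes refl | no m'≢l =
    unpaired-decoupled k<l (λ { _ refl → m'≢l refl }) ∷ lookupPair-zero⇒decoupled cs k<l u z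
  ... | no m≢k   | _       =
    unpaired-decoupled k<l (λ { _ refl → m≢k refl }) ∷ lookupPair-zero⇒decoupled cs k<l u z

  zeroCij⇒decoupled : (𝒞 : Instance n) {i j : Fin n} → i ≢ j → IsZeroFun (Cij 𝒞 i j) →
    All (Decoupled i j) (constraints 𝒞)
  zeroCij⇒decoupled 𝒞 {i} {j} i≢j zero with <-cmp i j
  ... | tri< i<j _ _ = lookupPair-zero⇒decoupled (constraints 𝒞) i<j (uniqueScopes 𝒞) zero
  ... | tri≈ _ i≡j _ = ⊥-elim (i≢j i≡j)
  ... | tri> _ _ j<i =
    All.map decoupled-sym
      (lookupPair-zero⇒decoupled (constraints 𝒞) j<i (uniqueScopes 𝒞) λ a b → zero b a)

  gainIndependent⇒¬signDepends : (𝒞 : Instance n) {i j : Fin n} →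
    GainIndependent (fitness 𝒞) i j → ¬ SignDepends 𝒞 i j
  gainIndependent⇒¬signDepends 𝒞 indep (x , edge , ¬edge) =
    ¬edge (<-from-equal-difference edge (sym (indep x)))

proposition3 : ∀ {n} (𝒞 : Instance n) (i j : Fin n) → i ≢ j →
    SignInteract 𝒞 i j → ¬ IsZeroFun (Cij 𝒞 i j)
proposition3 𝒞 i j i≢j (inj₁ i-dep-j) zero =
  gainIndependent⇒¬signDepends 𝒞 (sumC-gainIndependent (zeroCij⇒decoupled 𝒞 i≢j zero)) i-dep-j
proposition3 𝒞 i j i≢j (inj₂ j-dep-i) zero =
  gainIndependent⇒¬signDepends 𝒞
    (sumC-gainIndependent (All.map decoupled-sym (zeroCij⇒decoupled 𝒞 i≢j zero))) j-dep-i
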